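{- Let $t$ be a positive integer and $k\in\{1,2,3\}$, and let $I_k=[-k,k]=\{i\in\mathbb{Z}: -k\le i\le k\}$ and $D(I_k)=\max\{2,2k-1\}$. Then $\mathsf{s}'_t(I_k)=t+k(k-1)$ if and only if every integer in $[1,D(I_k)]$ divides $t$.
   Context: A sequence over a set $G_0\subseteq\mathbb{Z}$ is a finite unordered list of elements of $G_0$ with repetition allowed. Its length $|S|$ is the number of terms counted with multiplicity, and its sum $\sigma(S)$ is the sum of its terms; a subsequence is a sub-multiset; $S$ is zero-sum if $\sigma(S)=0$. $D(I_k)$ is the Davenport constant of $I_k$ (maximum length of a minimal zero-sum sequence over $I_k$), which equals $\max\{2,2k-1\}$. For a positive integer $t$, $\mathsf{s}'_t(I_k)$ is the smallest positive integer $\ell$ such that every zero-sum sequence $S$ over $I_k$ with $|S|\ge\ell$ contains a zero-sum subsequence of length $t$; if no such $\ell$ exists, $\mathsf{s}'_t(I_k)=\infty$. -}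

module Defs where

open import Data.Nat as ℕ using (ℕ; _∸_; _⊔_)
open import Data.Integer as ℤ using (ℤ; +_; -_)
open import Data.List using (List; foldr; length)
open import Data.List.Relation.Unary.All using (All)
open import Data.List.Relation.Binary.Sublist.Propositional using (_⊆_)
open import Data.Product using (_×_; ∃-syntax)
open import Relation.Binary.PropositionalEquality using (_≡_)
open import Relation.Nullary using (¬_)

InI : ℕ → ℤ → Set
InI k i = (- (+ k)) ℤ.≤ i × i ℤ.≤ + k

-- A sequence over I_k: a finite list of elements of I_k
-- (order is irrelevant for everything below).
SeqOver : ℕ → List ℤ → Set
SeqOver k S = All (InI k) S

σ : List ℤ → ℤ
σ = foldr ℤ._+_ (+ 0)

ZeroSum : List ℤ → Set
ZeroSum S = σ S ≡ + 0

-- Subsequence = sub-multiset; every sub-multiset of S can be listed as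
-- an (order-preserving) sublist of S, so we use the sublist relation.
Prop-s' : ℕ → ℕ → ℕ → Set
Prop-s' k t ℓ =
  (S : List ℤ) → SeqOver k S → ZeroSum S → ℓ ℕ.≤ length S →
  ∃[ T ] (T ⊆ S × ZeroSum T × length T ≡ t)

s'≡ : ℕ → ℕ → ℕ → Set
s'≡ k t ℓ =
  1 ℕ.≤ ℓ × Prop-s' k t ℓ ×
  ((m : ℕ) → 1 ℕ.≤ m → m ℕ.< ℓ → ¬ Prop-s' k t m)

D : ℕ → ℕ
D k = 2 ⊔ (2 ℕ.* k ∸ 1)

-- A sequence over I₃ is determined up to order by its vector of multiplicities, and it is
-- zero-sum exactly when that vector is balanced: m₁ + 2m₂ + 3m₃ = m₋₁ + 2m₋₂ + 3m₋₃. Let L = 2, 6, 60 = lcm(1, …, D(I_k)) for k = 1, 2, 3.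
--
-- Sufficiency: it is enough to find a balanced part of size L in every balanced vector of size
-- at least L + k(k − 1), and to iterate. Cancelling pairs {x, −x} leaves a residue in which every
-- value occurs with a single sign; a suitable balanced part of the residue (an explicit one when
-- the residue is large, otherwise one found by a finite search carried out by evaluation)
-- is padded up to size L with zeros and cancelled pairs.
--
-- Necessity: ℓ copies of 1 and of −1 (ℓ of 2 and 2ℓ of −1; ℓ of 3 and 3ℓ of −1; 2ℓ of 3 and
-- 3ℓ of −2) force 2 ∣ t (3 ∣ t; 4 ∣ t; 5 ∣ t), and explicit zero-sum sequences of length
-- t + k(k − 1) − 1 without zero-sum subsequences of length t show that s'_t cannot be smaller.

module Submission where

open import Defs
import Algebra.Properties.CommutativeSemigroup as CommutativeSemigroupProperties
open import Data.Bool.Base using (Bool; true; false; T; _∧_; _∨_; not; if_then_else_)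
open import Data.Bool.ListAction using (all; any)
open import Data.Bool.Properties using (T-∧; T-∨)
open import Data.Empty using (⊥-elim)
open import Data.Integer.Base as ℤ using (ℤ; +_; -[1+_]; +≤+; -≤-)
import Data.Integer.Properties as ℤ
open import Data.List.Base using (List; []; _∷_; _++_; length; replicate; concatMap; map; downFrom)
open import Data.List.Membership.Propositional.Properties using (∈-downFrom⁺)
open import Data.List.Relation.Binary.Sublist.Propositional using (_⊆_; []; _∷_; _∷ʳ_)
open import Data.List.Relation.Binary.Sublist.Propositional.Properties using (All-resp-⊆)
open import Data.List.Relation.Unary.All as All using (All; []; _∷_)
import Data.List.Relation.Unary.All.Properties as AllP
open import Data.List.Relation.Unary.Any using (satisfied)
open import Data.List.Relation.Unary.Any.Properties using (any⁻)
open import Data.Nat.Base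
open import Data.Nat.Coprimality using (coprime?; coprime-divisor)
open import Data.Nat.Divisibility using (_∣_; _∣?_; divides; 1∣_; ∣-refl; m∣m*n; ∣m+n∣m⇒∣n; ∣1⇒≡1; m%n≡0⇒n∣m)
open import Data.Nat.LCM using (lcm-least)
open import Data.Nat.ListAction using (sum)
open import Data.Nat.Properties
open import Data.Nat.Tactic.RingSolver using (solve-∀)
open import Data.Product.Base using (Σ-syntax; ∃-syntax; _×_; _,_; proj₁; proj₂)
open import Data.Sum.Base as Sum using (_⊎_; inj₁; inj₂)
open import Data.Unit.Base using (tt)
open import Function.Base using (_∘_)
open import Function.Bundles using (_⇔_; mk⇔; Equivalence)
open import Relation.Binary.PropositionalEquality
open import Relation.Nullary.Decidable.Core using (yes; no; does; toWitness; toWitnessFalse)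
open import Relation.Nullary.Negation.Core using (¬_)

-- Multiplicity vectors

record Mult : Set where
  constructor mk
  field
    m₀ m₁ m₂ m₃ m₋₁ m₋₂ m₋₃ : ℕ

open Mult

weight⁺ weight⁻ size : Mult → ℕ
weight⁺ c = m₁ c + (2 * m₂ c + 3 * m₃ c)
weight⁻ c = m₋₁ c + (2 * m₋₂ c + 3 * m₋₃ c)
size c = m₀ c + ((m₁ c + (m₂ c + m₃ c)) + (m₋₁ c + (m₋₂ c + m₋₃ c)))

Balanced : Mult → Set
Balanced c = weight⁺ c ≡ weight⁻ c

infix 4 _≤ᵐ_
infixl 6 _+ᵐ_ _∸ᵐ_

_≤ᵐ_ : Mult → Mult → Set
u ≤ᵐ v = m₀ u ≤ m₀ v × m₁ u ≤ m₁ v × m₂ u ≤ m₂ v × m₃ u ≤ m₃ v ×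
         m₋₁ u ≤ m₋₁ v × m₋₂ u ≤ m₋₂ v × m₋₃ u ≤ m₋₃ v

_+ᵐ_ _∸ᵐ_ : Mult → Mult → Mult
u +ᵐ v = mk (m₀ u + m₀ v) (m₁ u + m₁ v) (m₂ u + m₂ v) (m₃ u + m₃ v)
            (m₋₁ u + m₋₁ v) (m₋₂ u + m₋₂ v) (m₋₃ u + m₋₃ v)
u ∸ᵐ v = mk (m₀ u ∸ m₀ v) (m₁ u ∸ m₁ v) (m₂ u ∸ m₂ v) (m₃ u ∸ m₃ v)
            (m₋₁ u ∸ m₋₁ v) (m₋₂ u ∸ m₋₂ v) (m₋₃ u ∸ m₋₃ v)

mirror : Mult → Mult
mirror c = mk (m₀ c) (m₋₁ c) (m₋₂ c) (m₋₃ c) (m₁ c) (m₂ c) (m₃ c)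

BalancedPart : Mult → ℕ → Set
BalancedPart n t = Σ[ u ∈ Mult ] u ≤ᵐ n × Balanced u × size u ≡ t

+ᵐ-mono-≤ᵐ : ∀ {u v u′ v′} → u ≤ᵐ v → u′ ≤ᵐ v′ → u +ᵐ u′ ≤ᵐ v +ᵐ v′
+ᵐ-mono-≤ᵐ (l₀ , l₁ , l₂ , l₃ , l₄ , l₅ , l₆) (k₀ , k₁ , k₂ , k₃ , k₄ , k₅ , k₆) =
  +-mono-≤ l₀ k₀ , +-mono-≤ l₁ k₁ , +-mono-≤ l₂ k₂ , +-mono-≤ l₃ k₃ ,
  +-mono-≤ l₄ k₄ , +-mono-≤ l₅ k₅ , +-mono-≤ l₆ k₆

+ᵐ-∸ᵐ : ∀ {u v} → u ≤ᵐ v → u +ᵐ (v ∸ᵐ u) ≡ v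
+ᵐ-∸ᵐ (l₀ , l₁ , l₂ , l₃ , l₄ , l₅ , l₆)
  rewrite m+[n∸m]≡n l₀ | m+[n∸m]≡n l₁ | m+[n∸m]≡n l₂ | m+[n∸m]≡n l₃
        | m+[n∸m]≡n l₄ | m+[n∸m]≡n l₅ | m+[n∸m]≡n l₆ = refl

∸ᵐ-≤ᵐ : ∀ u v → u ∸ᵐ v ≤ᵐ u
∸ᵐ-≤ᵐ u v =
  m∸n≤m (m₀ u) (m₀ v) , m∸n≤m (m₁ u) (m₁ v) , m∸n≤m (m₂ u) (m₂ v) , m∸n≤m (m₃ u) (m₃ v) ,
  m∸n≤m (m₋₁ u) (m₋₁ v) , m∸n≤m (m₋₂ u) (m₋₂ v) , m∸n≤m (m₋₃ u) (m₋₃ v)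

≤ᵐ-refl : ∀ {u} → u ≤ᵐ u
≤ᵐ-refl = ≤-refl , ≤-refl , ≤-refl , ≤-refl , ≤-refl , ≤-refl , ≤-refl

≤ᵐ-+ᵐ : ∀ u v → u ≤ᵐ u +ᵐ v
≤ᵐ-+ᵐ u v =
  m≤m+n (m₀ u) (m₀ v) , m≤m+n (m₁ u) (m₁ v) , m≤m+n (m₂ u) (m₂ v) , m≤m+n (m₃ u) (m₃ v) ,
  m≤m+n (m₋₁ u) (m₋₁ v) , m≤m+n (m₋₂ u) (m₋₂ v) , m≤m+n (m₋₃ u) (m₋₃ v)

weight-+ : ∀ a b c a′ b′ c′ →
  (a + a′) + (2 * (b + b′) + 3 * (c + c′)) ≡ (a + (2 * b + 3 * c)) + (a′ + (2 * b′ + 3 * c′))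
weight-+ = solve-∀

weight⁺-+ᵐ : ∀ u v → weight⁺ (u +ᵐ v) ≡ weight⁺ u + weight⁺ v
weight⁺-+ᵐ u v = weight-+ (m₁ u) (m₂ u) (m₃ u) (m₁ v) (m₂ v) (m₃ v)

weight⁻-+ᵐ : ∀ u v → weight⁻ (u +ᵐ v) ≡ weight⁻ u + weight⁻ v
weight⁻-+ᵐ u v = weight-+ (m₋₁ u) (m₋₂ u) (m₋₃ u) (m₋₁ v) (m₋₂ v) (m₋₃ v)

size-+ᵐ : ∀ u v → size (u +ᵐ v) ≡ size u + size v
size-+ᵐ u v = lemma (m₀ u) (m₁ u) (m₂ u) (m₃ u) (m₋₁ u) (m₋₂ u) (m₋₃ u)
                    (m₀ v) (m₁ v) (m₂ v) (m₃ v) (m₋₁ v) (m₋₂ v) (m₋₃ v)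
  where
  lemma : ∀ z a₁ a₂ a₃ b₁ b₂ b₃ z′ a₁′ a₂′ a₃′ b₁′ b₂′ b₃′ →
    (z + z′) + (((a₁ + a₁′) + ((a₂ + a₂′) + (a₃ + a₃′))) + ((b₁ + b₁′) + ((b₂ + b₂′) + (b₃ + b₃′)))) ≡
    (z + ((a₁ + (a₂ + a₃)) + (b₁ + (b₂ + b₃)))) + (z′ + ((a₁′ + (a₂′ + a₃′)) + (b₁′ + (b₂′ + b₃′))))
  lemma = solve-∀

size-mono : ∀ {u v} → u ≤ᵐ v → size u ≤ size v
size-mono (l₀ , l₁ , l₂ , l₃ , l₄ , l₅ , l₆) =
  +-mono-≤ l₀ (+-mono-≤ (+-mono-≤ l₁ (+-mono-≤ l₂ l₃)) (+-mono-≤ l₄ (+-mono-≤ l₅ l₆)))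

Balanced-+ᵐ : ∀ u v → Balanced u → Balanced v → Balanced (u +ᵐ v)
Balanced-+ᵐ u v bu bv = begin
  weight⁺ (u +ᵐ v)          ≡⟨ weight⁺-+ᵐ u v ⟩
  weight⁺ u + weight⁺ v     ≡⟨ cong₂ _+_ bu bv ⟩
  weight⁻ u + weight⁻ v     ≡⟨ weight⁻-+ᵐ u v ⟨
  weight⁻ (u +ᵐ v)          ∎
  where open ≡-Reasoning

Balanced-cancelˡ : ∀ u v → Balanced u → Balanced (u +ᵐ v) → Balanced v
Balanced-cancelˡ u v bu buv = +-cancelˡ-≡ (weight⁺ u) _ _ (begin
  weight⁺ u + weight⁺ v     ≡⟨ weight⁺-+ᵐ u v ⟨
  weight⁺ (u +ᵐ v)          ≡⟨ buv ⟩
  weight⁻ (u +ᵐ v)          ≡⟨ weight⁻-+ᵐ u v ⟩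
  weight⁻ u + weight⁻ v     ≡⟨ cong (_+ weight⁻ v) bu ⟨
  weight⁺ u + weight⁻ v     ∎)
  where open ≡-Reasoning

Balanced-cancelʳ : ∀ u v → Balanced v → Balanced (u +ᵐ v) → Balanced u
Balanced-cancelʳ u v bv buv = +-cancelʳ-≡ (weight⁺ v) _ _ (begin
  weight⁺ u + weight⁺ v     ≡⟨ weight⁺-+ᵐ u v ⟨
  weight⁺ (u +ᵐ v)          ≡⟨ buv ⟩
  weight⁻ (u +ᵐ v)          ≡⟨ weight⁻-+ᵐ u v ⟩
  weight⁻ u + weight⁻ v     ≡⟨ cong (_+_ (weight⁻ u)) bv ⟨
  weight⁻ u + weight⁺ v     ∎)
  where open ≡-Reasoning

size-mirror : ∀ c → size (mirror c) ≡ size c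
size-mirror c = cong (_+_ (m₀ c)) (+-comm (m₋₁ c + (m₋₂ c + m₋₃ c)) (m₁ c + (m₂ c + m₃ c)))

mirror-mono-≤ᵐ : ∀ {u v} → u ≤ᵐ v → mirror u ≤ᵐ mirror v
mirror-mono-≤ᵐ (l₀ , l₁ , l₂ , l₃ , l₄ , l₅ , l₆) = l₀ , l₄ , l₅ , l₆ , l₁ , l₂ , l₃

multiplicity : List ℤ → ℤ → ℕ
multiplicity []       v = 0
multiplicity (x ∷ xs) v with x ℤ.≟ v
... | yes _ = suc (multiplicity xs v)
... | no  _ = multiplicity xs v

-- Terms outside I₃ are not counted.
mults : List ℤ → Mult
mults S = mk (multiplicity S (+ 0))
             (multiplicity S (+ 1)) (multiplicity S (+ 2)) (multiplicity S (+ 3))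
             (multiplicity S -[1+ 0 ]) (multiplicity S -[1+ 1 ]) (multiplicity S -[1+ 2 ])

mults-∷ : ∀ x S → mults (x ∷ S) ≡ mults (x ∷ []) +ᵐ mults S
mults-∷ (+ 0)                             S = refl
mults-∷ (+ 1)                             S = refl
mults-∷ (+ 2)                             S = refl
mults-∷ (+ 3)                             S = refl
mults-∷ (+ suc (suc (suc (suc _))))       S = refl
mults-∷ -[1+ 0 ]                          S = refl
mults-∷ -[1+ 1 ]                          S = refl
mults-∷ -[1+ 2 ]                          S = refl
mults-∷ -[1+ suc (suc (suc _)) ]          S = refl

signedWeight : Mult → ℤ
signedWeight c = + weight⁺ c ℤ.- + weight⁻ c

signedWeight-+ᵐ : ∀ u v → signedWeight (u +ᵐ v) ≡ signedWeight u ℤ.+ signedWeight v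
signedWeight-+ᵐ u v = begin
  + weight⁺ (u +ᵐ v) ℤ.- + weight⁻ (u +ᵐ v)
    ≡⟨ cong₂ (λ p n → + p ℤ.- + n) (weight⁺-+ᵐ u v) (weight⁻-+ᵐ u v) ⟩
  + (weight⁺ u + weight⁺ v) ℤ.- + (weight⁻ u + weight⁻ v)
    ≡⟨ cong₂ ℤ._-_ (ℤ.pos-+ (weight⁺ u) (weight⁺ v)) (ℤ.pos-+ (weight⁻ u) (weight⁻ v)) ⟩
  (a ℤ.+ b) ℤ.- (c ℤ.+ d)
    ≡⟨ cong (ℤ._+_ (a ℤ.+ b)) (ℤ.neg-distrib-+ c d) ⟩
  (a ℤ.+ b) ℤ.+ (ℤ.- c ℤ.+ ℤ.- d)
    ≡⟨ interchange a b (ℤ.- c) (ℤ.- d) ⟩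
  (a ℤ.- c) ℤ.+ (b ℤ.- d) ∎
  where
  open ≡-Reasoning
  open CommutativeSemigroupProperties ℤ.+-commutativeSemigroup using (interchange)
  a = + weight⁺ u
  b = + weight⁺ v
  c = + weight⁻ u
  d = + weight⁻ v

signedWeight≡0⇒Balanced : ∀ c → signedWeight c ≡ + 0 → Balanced c
signedWeight≡0⇒Balanced c e = ℤ.+-injective (ℤ.i-j≡0⇒i≡j _ _ e)

Balanced⇒signedWeight≡0 : ∀ c → Balanced c → signedWeight c ≡ + 0
Balanced⇒signedWeight≡0 c b = ℤ.i≡j⇒i-j≡0 (cong +_ b)

size-single : ∀ {x} → InI 3 x → size (mults (x ∷ [])) ≡ 1
size-single {+ 0}                       _ = refl
size-single {+ 1}                       _ = refl
size-single {+ 2}                       _ = refl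
size-single {+ 3}                       _ = refl
size-single {+ suc (suc (suc (suc _)))} (_ , +≤+ (s≤s (s≤s (s≤s ()))))
size-single { -[1+ 0 ] }                _ = refl
size-single { -[1+ 1 ] }                _ = refl
size-single { -[1+ 2 ] }                _ = refl
size-single { -[1+ suc (suc (suc _)) ] } (-≤- (s≤s (s≤s ())) , _)

signedWeight-single : ∀ {x} → InI 3 x → signedWeight (mults (x ∷ [])) ≡ x
signedWeight-single {+ 0}                       _ = refl
signedWeight-single {+ 1}                       _ = refl
signedWeight-single {+ 2}                       _ = refl
signedWeight-single {+ 3}                       _ = refl
signedWeight-single {+ suc (suc (suc (suc _)))} (_ , +≤+ (s≤s (s≤s (s≤s ()))))
signedWeight-single { -[1+ 0 ] }                _ = refl
signedWeight-single { -[1+ 1 ] }                _ = refl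
signedWeight-single { -[1+ 2 ] }                _ = refl
signedWeight-single { -[1+ suc (suc (suc _)) ] } (-≤- (s≤s (s≤s ())) , _)

length≡size : ∀ {S} → All (InI 3) S → length S ≡ size (mults S)
length≡size [] = refl
length≡size {x ∷ S} (px ∷ ps) = begin
  suc (length S)                         ≡⟨ cong suc (length≡size ps) ⟩
  suc (size (mults S))                   ≡⟨ cong (_+ size (mults S)) (size-single px) ⟨
  size (mults (x ∷ [])) + size (mults S) ≡⟨ size-+ᵐ (mults (x ∷ [])) (mults S) ⟨
  size (mults (x ∷ []) +ᵐ mults S)       ≡⟨ cong size (mults-∷ x S) ⟨
  size (mults (x ∷ S))                   ∎
  where open ≡-Reasoning

σ≡signedWeight : ∀ {S} → All (InI 3) S → σ S ≡ signedWeight (mults S)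
σ≡signedWeight [] = refl
σ≡signedWeight {x ∷ S} (px ∷ ps) = begin
  x ℤ.+ σ S
    ≡⟨ cong₂ ℤ._+_ (sym (signedWeight-single px)) (σ≡signedWeight ps) ⟩
  signedWeight (mults (x ∷ [])) ℤ.+ signedWeight (mults S)
    ≡⟨ signedWeight-+ᵐ (mults (x ∷ [])) (mults S) ⟨
  signedWeight (mults (x ∷ []) +ᵐ mults S)
    ≡⟨ cong signedWeight (mults-∷ x S) ⟨
  signedWeight (mults (x ∷ S))
    ∎
  where open ≡-Reasoning

ZeroSum⇒Balanced : ∀ {S} → All (InI 3) S → ZeroSum S → Balanced (mults S)
ZeroSum⇒Balanced {S} ps z = signedWeight≡0⇒Balanced (mults S) (trans (sym (σ≡signedWeight ps)) z)

Balanced⇒ZeroSum : ∀ {S} → All (InI 3) S → Balanced (mults S) → ZeroSum S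
Balanced⇒ZeroSum {S} ps b = trans (σ≡signedWeight ps) (Balanced⇒signedWeight≡0 (mults S) b)

multiplicity-≡ : ∀ x xs → multiplicity (x ∷ xs) x ≡ suc (multiplicity xs x)
multiplicity-≡ x xs with x ℤ.≟ x
... | yes _  = refl
... | no x≢x = ⊥-elim (x≢x refl)

multiplicity-≢ : ∀ {x v} xs → x ≢ v → multiplicity (x ∷ xs) v ≡ multiplicity xs v
multiplicity-≢ {x} {v} xs x≢v with x ℤ.≟ v
... | yes x≡v = ⊥-elim (x≢v x≡v)
... | no  _   = refl

multiplicity-mono : ∀ {T S} → T ⊆ S → ∀ v → multiplicity T v ≤ multiplicity S v
multiplicity-mono [] v = z≤n
multiplicity-mono (y ∷ʳ p) v with y ℤ.≟ v
... | yes _ = m≤n⇒m≤1+n (multiplicity-mono p v)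
... | no  _ = multiplicity-mono p v
multiplicity-mono (_∷_ {x = x} refl p) v with x ℤ.≟ v
... | yes _ = s≤s (multiplicity-mono p v)
... | no  _ = multiplicity-mono p v

mults-mono : ∀ {T S} → T ⊆ S → mults T ≤ᵐ mults S
mults-mono p = let m = multiplicity-mono p in m _ , m _ , m _ , m _ , m _ , m _ , m _

lookupᵐ : Mult → ℤ → ℕ
lookupᵐ c (+ 0)                         = m₀ c
lookupᵐ c (+ 1)                         = m₁ c
lookupᵐ c (+ 2)                         = m₂ c
lookupᵐ c (+ 3)                         = m₃ c
lookupᵐ c (+ suc (suc (suc (suc _))))   = 0
lookupᵐ c -[1+ 0 ]                      = m₋₁ c
lookupᵐ c -[1+ 1 ]                      = m₋₂ c
lookupᵐ c -[1+ 2 ]                      = m₋₃ c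
lookupᵐ c -[1+ suc (suc (suc _)) ]      = 0

lookupᵐ-mono : ∀ {u v} → u ≤ᵐ v → ∀ w → lookupᵐ u w ≤ lookupᵐ v w
lookupᵐ-mono (l₀ , l₁ , l₂ , l₃ , l₄ , l₅ , l₆) (+ 0)                       = l₀
lookupᵐ-mono (l₀ , l₁ , l₂ , l₃ , l₄ , l₅ , l₆) (+ 1)                       = l₁
lookupᵐ-mono (l₀ , l₁ , l₂ , l₃ , l₄ , l₅ , l₆) (+ 2)                       = l₂
lookupᵐ-mono (l₀ , l₁ , l₂ , l₃ , l₄ , l₅ , l₆) (+ 3)                       = l₃
lookupᵐ-mono (l₀ , l₁ , l₂ , l₃ , l₄ , l₅ , l₆) (+ suc (suc (suc (suc _)))) = z≤n
lookupᵐ-mono (l₀ , l₁ , l₂ , l₃ , l₄ , l₅ , l₆) -[1+ 0 ]                    = l₄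
lookupᵐ-mono (l₀ , l₁ , l₂ , l₃ , l₄ , l₅ , l₆) -[1+ 1 ]                    = l₅
lookupᵐ-mono (l₀ , l₁ , l₂ , l₃ , l₄ , l₅ , l₆) -[1+ 2 ]                    = l₆
lookupᵐ-mono (l₀ , l₁ , l₂ , l₃ , l₄ , l₅ , l₆) -[1+ suc (suc (suc _)) ]    = z≤n

lookupᵐ-mults : ∀ S v → lookupᵐ (mults S) v ≤ multiplicity S v
lookupᵐ-mults S (+ 0)                       = ≤-refl
lookupᵐ-mults S (+ 1)                       = ≤-refl
lookupᵐ-mults S (+ 2)                       = ≤-refl
lookupᵐ-mults S (+ 3)                       = ≤-refl
lookupᵐ-mults S (+ suc (suc (suc (suc _)))) = z≤n
lookupᵐ-mults S -[1+ 0 ]                    = ≤-refl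
lookupᵐ-mults S -[1+ 1 ]                    = ≤-refl
lookupᵐ-mults S -[1+ 2 ]                    = ≤-refl
lookupᵐ-mults S -[1+ suc (suc (suc _)) ]    = z≤n

mults≡ : ∀ S {c} → (∀ v → multiplicity S v ≡ lookupᵐ c v) → mults S ≡ c
mults≡ S h
  rewrite h (+ 0) | h (+ 1) | h (+ 2) | h (+ 3) | h -[1+ 0 ] | h -[1+ 1 ] | h -[1+ 2 ] = refl

pred-at : ℤ → (ℤ → ℕ) → ℤ → ℕ
pred-at x f v with x ℤ.≟ v
... | yes _ = pred (f v)
... | no  _ = f v

select : (ℤ → ℕ) → List ℤ → List ℤ
select f []       = []
select f (x ∷ xs) with f x
... | zero  = select f xs
... | suc _ = x ∷ select (pred-at x f) xs

select-⊆ : ∀ f xs → select f xs ⊆ xs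
select-⊆ f []       = []
select-⊆ f (x ∷ xs) with f x
... | zero  = x ∷ʳ select-⊆ f xs
... | suc _ = refl ∷ select-⊆ (pred-at x f) xs

multiplicity-select : ∀ f xs → (∀ v → f v ≤ multiplicity xs v) →
                      ∀ v → multiplicity (select f xs) v ≡ f v
multiplicity-select f []       f≤ v = sym (n≤0⇒n≡0 (f≤ v))
multiplicity-select f (x ∷ xs) f≤ v with f x in fx
... | zero  = multiplicity-select f xs f≤′ v
  where
  f≤′ : ∀ w → f w ≤ multiplicity xs w
  f≤′ w with x ℤ.≟ w
  ... | yes refl = subst (_≤ multiplicity xs x) (sym fx) z≤n
  ... | no  x≢w  = subst (f w ≤_) (multiplicity-≢ xs x≢w) (f≤ w)
... | suc _ = step
  where
  f≤′ : ∀ w → pred-at x f w ≤ multiplicity xs w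
  f≤′ w with x ℤ.≟ w
  ... | yes refl = pred-mono-≤ (subst (f x ≤_) (multiplicity-≡ x xs) (f≤ x))
  ... | no  x≢w  = subst (f w ≤_) (multiplicity-≢ xs x≢w) (f≤ w)
  step : multiplicity (x ∷ select (pred-at x f) xs) v ≡ f v
  step with x ℤ.≟ v | multiplicity-select (pred-at x f) xs f≤′ v
  ... | yes refl | ih = trans (cong suc ih) (sym fx′)
    where
    fx′ : f x ≡ suc (pred (f x))
    fx′ rewrite fx = refl
  ... | no  _    | ih = ih

realise : ∀ {S c} → c ≤ᵐ mults S → Σ[ T ∈ List ℤ ] T ⊆ S × mults T ≡ c
realise {S} {c} c≤ =
  select (lookupᵐ c) S , select-⊆ (lookupᵐ c) S ,
  mults≡ (select (lookupᵐ c) S)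
    (multiplicity-select (lookupᵐ c) S λ v → ≤-trans (lookupᵐ-mono c≤ v) (lookupᵐ-mults S v))

values₃ : List ℤ
values₃ = + 0 ∷ + 1 ∷ + 2 ∷ + 3 ∷ -[1+ 0 ] ∷ -[1+ 1 ] ∷ -[1+ 2 ] ∷ []

listing : Mult → List ℤ
listing c = concatMap (λ v → replicate (lookupᵐ c v) v) values₃

multiplicity-++ : ∀ xs ys v → multiplicity (xs ++ ys) v ≡ multiplicity xs v + multiplicity ys v
multiplicity-++ []       ys v = refl
multiplicity-++ (x ∷ xs) ys v with x ℤ.≟ v
... | yes _ = cong suc (multiplicity-++ xs ys v)
... | no  _ = multiplicity-++ xs ys v

multiplicity-replicate : ∀ n x v →
  multiplicity (replicate n x) v ≡ (if does (x ℤ.≟ v) then n else 0)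
multiplicity-replicate zero x v with x ℤ.≟ v
... | yes _ = refl
... | no  _ = refl
multiplicity-replicate (suc n) x v with x ℤ.≟ v | multiplicity-replicate n x v
... | yes _ | ih = cong suc ih
... | no  _ | ih = ih

multiplicity-spread : ∀ (f : ℤ → ℕ) ws v →
  multiplicity (concatMap (λ w → replicate (f w) w) ws) v ≡
  sum (map (λ w → if does (w ℤ.≟ v) then f w else 0) ws)
multiplicity-spread f []       v = refl
multiplicity-spread f (w ∷ ws) v =
  trans (multiplicity-++ (replicate (f w) w) _ v)
        (cong₂ _+_ (multiplicity-replicate (f w) w v) (multiplicity-spread f ws v))

multiplicity-listing : ∀ c v → multiplicity (listing c) v ≡ lookupᵐ c v
multiplicity-listing c v = trans (multiplicity-spread (lookupᵐ c) values₃ v) (pick v)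
  where
  pick : ∀ v → sum (map (λ w → if does (w ℤ.≟ v) then lookupᵐ c w else 0) values₃) ≡ lookupᵐ c v
  pick (+ 0)                       = +-identityʳ _
  pick (+ 1)                       = +-identityʳ _
  pick (+ 2)                       = +-identityʳ _
  pick (+ 3)                       = +-identityʳ _
  pick (+ suc (suc (suc (suc _)))) = refl
  pick -[1+ 0 ]                    = +-identityʳ _
  pick -[1+ 1 ]                    = +-identityʳ _
  pick -[1+ 2 ]                    = +-identityʳ _
  pick -[1+ suc (suc (suc _)) ]    = refl

mults-listing : ∀ c → mults (listing c) ≡ c
mults-listing c = mults≡ (listing c) (multiplicity-listing c)

+∈I : ∀ {k n} → n ≤ k → InI k (+ n)
+∈I n≤k = ℤ.neg-≤-pos , +≤+ n≤k

-∈I : ∀ {k n} → n ≤ k → InI k (ℤ.- (+ n))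
-∈I n≤k = ℤ.neg-mono-≤ (+≤+ n≤k) , ℤ.neg-≤-pos

+∉I : ∀ {k n} → k < n → ¬ InI k (+ n)
+∉I k<n (_ , +≤+ n≤k) = <⇒≱ k<n n≤k

-∉I : ∀ {k n} → k ≤ n → ¬ InI k -[1+ n ]
-∉I {zero}  _   (() , _)
-∉I {suc k} k<n (-≤- n≤k , _) = <⇒≱ k<n n≤k

I-mono : ∀ {k l x} → k ≤ l → InI k x → InI l x
I-mono k≤l (lo , hi) = ℤ.≤-trans (ℤ.neg-mono-≤ (+≤+ k≤l)) lo , ℤ.≤-trans hi (+≤+ k≤l)

listing-I₃ : ∀ c → All (InI 3) (listing c)
listing-I₃ c = AllP.concat⁺
  (AllP.replicate⁺ (m₀ c) (+∈I z≤n) ∷ AllP.replicate⁺ (m₁ c) (+∈I (s≤s z≤n)) ∷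
   AllP.replicate⁺ (m₂ c) (+∈I (s≤s (s≤s z≤n))) ∷ AllP.replicate⁺ (m₃ c) (+∈I ≤-refl) ∷
   AllP.replicate⁺ (m₋₁ c) (-∈I (s≤s z≤n)) ∷ AllP.replicate⁺ (m₋₂ c) (-∈I (s≤s (s≤s z≤n))) ∷
   AllP.replicate⁺ (m₋₃ c) (-∈I ≤-refl) ∷ [])

Supported : ℕ → Mult → Set
Supported k c = ∀ v → ¬ InI k v → lookupᵐ c v ≡ 0

Supported-≤ : ∀ {k u v} → u ≤ᵐ v → Supported k v → Supported k u
Supported-≤ {u = u} u≤v sv w w∉ =
  n≤0⇒n≡0 (subst (lookupᵐ u w ≤_) (sv w w∉) (lookupᵐ-mono u≤v w))

multiplicity-outside : ∀ {k S v} → All (InI k) S → ¬ InI k v → multiplicity S v ≡ 0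
multiplicity-outside []                       v∉ = refl
multiplicity-outside {v = v} (_∷_ {x} px ps) v∉ with x ℤ.≟ v
... | yes refl = ⊥-elim (v∉ px)
... | no  _    = multiplicity-outside ps v∉

mults-supported : ∀ {k S} → All (InI k) S → Supported k (mults S)
mults-supported {S = S} ps v v∉ =
  n≤0⇒n≡0 (subst (lookupᵐ (mults S) v ≤_) (multiplicity-outside ps v∉) (lookupᵐ-mults S v))

zeroSumSubsequence : ∀ {S t} → All (InI 3) S → BalancedPart (mults S) t →
                     ∃[ T ] (T ⊆ S × ZeroSum T × length T ≡ t)
zeroSumSubsequence {S} S∈I (c , c≤ , bc , size≡t) with realise {S} c≤
... | T , T⊆S , refl = T , T⊆S , Balanced⇒ZeroSum T∈I bc , trans (length≡size T∈I) size≡t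
  where
  T∈I : All (InI 3) T
  T∈I = All-resp-⊆ T⊆S S∈I

balancedPart-of-listing : ∀ {k t ℓ} c → All (InI k) (listing c) → Balanced c → ℓ ≤ size c →
                          Prop-s' k t ℓ → BalancedPart c t
balancedPart-of-listing {ℓ = ℓ} c over bc ℓ≤ P with P (listing c) over zeroSum long
  where
  zeroSum : ZeroSum (listing c)
  zeroSum = Balanced⇒ZeroSum (listing-I₃ c) (subst Balanced (sym (mults-listing c)) bc)
  long : ℓ ≤ length (listing c)
  long = subst (ℓ ≤_) (sym (trans (length≡size (listing-I₃ c)) (cong size (mults-listing c)))) ℓ≤
... | T , T⊆ , zT , lenT =
  mults T , subst (mults T ≤ᵐ_) (mults-listing c) (mults-mono T⊆) ,
  ZeroSum⇒Balanced T∈I zT , trans (sym (length≡size T∈I)) lenT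
  where
  T∈I : All (InI 3) T
  T∈I = All-resp-⊆ T⊆ (listing-I₃ c)

HasBalancedParts : ℕ → ℕ → ℕ → Set
HasBalancedParts k L K = ∀ {n} → Supported k n → Balanced n → K ≤ size n → BalancedPart n L

Prop-s'-of-parts : ∀ {k t ℓ} → k ≤ 3 → HasBalancedParts k t ℓ → Prop-s' k t ℓ
Prop-s'-of-parts {ℓ = ℓ} k≤3 parts S S∈Iₖ zs ℓ≤ =
  zeroSumSubsequence S∈I₃ (parts (mults-supported S∈Iₖ) (ZeroSum⇒Balanced S∈I₃ zs)
                                 (subst (ℓ ≤_) (length≡size S∈I₃) ℓ≤))
  where
  S∈I₃ : All (InI 3) S
  S∈I₃ = All.map (I-mono k≤3) S∈Iₖ

iterate-parts : ∀ {k L s} → HasBalancedParts k L (L + s) → ∀ j → HasBalancedParts k (j * L) (j * L + s)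
iterate-parts parts zero _ _ _ =
  mk 0 0 0 0 0 0 0 , (z≤n , z≤n , z≤n , z≤n , z≤n , z≤n , z≤n) , refl , refl
iterate-parts {L = L} {s} parts (suc j) {n} sn bn le =
  first (parts sn bn (≤-trans (+-monoˡ-≤ s (m≤m+n L (j * L))) le))
  where
  first : BalancedPart n L → BalancedPart n (suc j * L)
  first (u , u≤n , bu , size-u) = rest (iterate-parts parts j sn′ bn′ fits)
    where
    n≡ : u +ᵐ (n ∸ᵐ u) ≡ n
    n≡ = +ᵐ-∸ᵐ u≤n
    sn′ : Supported _ (n ∸ᵐ u)
    sn′ = Supported-≤ (∸ᵐ-≤ᵐ n u) sn
    bn′ : Balanced (n ∸ᵐ u)
    bn′ = Balanced-cancelˡ u (n ∸ᵐ u) bu (subst Balanced (sym n≡) bn)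
    fits : j * L + s ≤ size (n ∸ᵐ u)
    fits = +-cancelˡ-≤ L _ _ (begin
      L + (j * L + s)         ≡⟨ +-assoc L (j * L) s ⟨
      L + j * L + s           ≤⟨ le ⟩
      size n                  ≡⟨ cong size n≡ ⟨
      size (u +ᵐ (n ∸ᵐ u))    ≡⟨ size-+ᵐ u (n ∸ᵐ u) ⟩
      size u + size (n ∸ᵐ u)  ≡⟨ cong (_+ size (n ∸ᵐ u)) size-u ⟩
      L + size (n ∸ᵐ u)       ∎)
      where open ≤-Reasoning
    rest : BalancedPart (n ∸ᵐ u) (j * L) → BalancedPart n (suc j * L)
    rest (v , v≤ , bv , size-v) =
      u +ᵐ v , subst (u +ᵐ v ≤ᵐ_) n≡ (+ᵐ-mono-≤ᵐ ≤ᵐ-refl v≤) ,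
      Balanced-+ᵐ u v bu bv , trans (size-+ᵐ u v) (cong₂ _+_ size-u size-v)

-- Cancelling opposite pairs

pairs : ℕ → ℕ → ℕ → ℕ → Mult
pairs z p₁ p₂ p₃ = mk z p₁ p₂ p₃ p₁ p₂ p₃

OneSigned : Mult → Set
OneSigned R =
  m₀ R ≡ 0 × (m₁ R ≡ 0 ⊎ m₋₁ R ≡ 0) × (m₂ R ≡ 0 ⊎ m₋₂ R ≡ 0) × (m₃ R ≡ 0 ⊎ m₋₃ R ≡ 0)

split-common : ∀ a b → ∃[ p ] ∃[ r ] ∃[ s ] (a ≡ r + p × b ≡ s + p × (r ≡ 0 ⊎ s ≡ 0))
split-common zero    b       = 0 , 0 , b , refl , sym (+-identityʳ b) , inj₁ refl
split-common (suc a) zero    = 0 , suc a , 0 , sym (+-identityʳ (suc a)) , refl , inj₂ refl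
split-common (suc a) (suc b) with split-common a b
... | p , r , s , refl , refl , rs = suc p , r , s , sym (+-suc r p) , sym (+-suc s p) , rs

decompose : ∀ n → ∃[ R ] ∃[ z ] ∃[ p₁ ] ∃[ p₂ ] ∃[ p₃ ] (OneSigned R × n ≡ R +ᵐ pairs z p₁ p₂ p₃)
decompose (mk z a₁ a₂ a₃ b₁ b₂ b₃)
  with split-common a₁ b₁ | split-common a₂ b₂ | split-common a₃ b₃
... | p₁ , r₁ , s₁ , refl , refl , o₁
    | p₂ , r₂ , s₂ , refl , refl , o₂
    | p₃ , r₃ , s₃ , refl , refl , o₃ =
  mk 0 r₁ r₂ r₃ s₁ s₂ s₃ , z , p₁ , p₂ , p₃ , (refl , o₁ , o₂ , o₃) , refl

+-suc-suc : ∀ a b → a + (suc b + suc b) ≡ suc (suc (a + (b + b)))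
+-suc-suc = solve-∀

pad : ∀ D z P → D ≤ z + (P + P) → 0 < z ⊎ 2 ∣ D →
      ∃[ q ] ∃[ H ] (q ≤ z × H ≤ P × q + (H + H) ≡ D)
pad zero          z P       _  _          = 0 , 0 , z≤n , z≤n , refl
pad (suc zero)    z P       _  (inj₁ 0<z) = 1 , 0 , 0<z , z≤n , refl
pad (suc zero)    z P       _  (inj₂ 2∣1) with () ← ∣1⇒≡1 2∣1
pad (suc (suc D)) z zero    D≤ _          =
  suc (suc D) , 0 , subst (suc (suc D) ≤_) (+-identityʳ z) D≤ , z≤n , +-identityʳ _
pad (suc (suc D)) z (suc P) D≤ parity
  with pad D z P (s≤s⁻¹ (s≤s⁻¹ (subst (suc (suc D) ≤_) (+-suc-suc z P) D≤)))
                 (Sum.map₂ (λ 2∣2+D → ∣m+n∣m⇒∣n 2∣2+D ∣-refl) parity)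
... | q , H , q≤z , H≤P , e =
  q , suc H , q≤z , s≤s H≤P , trans (+-suc-suc q H) (cong (suc ∘ suc) e)

split-≤ : ∀ {H a b} → H ≤ a + b → ∃[ x ] ∃[ y ] (x ≤ a × y ≤ b × x + y ≡ H)
split-≤ {H} {a} H≤ = a ⊓ H , H ∸ a , m⊓n≤m a H , m≤n+o⇒m∸n≤o H a H≤ , m⊓n+n∸m≡n a H

-- A balanced part of the residue R that z zeros and P pairs {x, −x} can pad up to size L;
-- without zeros the padding has even size.
record Completable (L : ℕ) (R : Mult) (z P : ℕ) : Set where
  constructor completion
  field
    part          : Mult
    part-≤        : part ≤ᵐ R
    part-balanced : Balanced part
    part-short    : size part ≤ L
    part-padded   : L ≤ size part + (z + (P + P))
    part-parity   : 0 < z ⊎ 2 ∣ size part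

ResidueSolver : ℕ → ℕ → ℕ → Set
ResidueSolver k L K = ∀ {R z P} → Supported k R → OneSigned R → Balanced R →
                      K ≤ size R + (z + (P + P)) → Completable L R z P

completion⇒part : ∀ {L R z p₁ p₂ p₃} → 2 ∣ L → Completable L R z (p₁ + (p₂ + p₃)) →
                  BalancedPart (R +ᵐ pairs z p₁ p₂ p₃) L
completion⇒part {L} {R} {z} {p₁} {p₂} {p₃} 2∣L (completion u u≤R bu u≤L L≤ parity)
  with pad (L ∸ size u) z (p₁ + (p₂ + p₃)) (m≤n+o⇒m∸n≤o L (size u) L≤) (Sum.map₂ even-rest parity)
  where
  even-rest : 2 ∣ size u → 2 ∣ L ∸ size u
  even-rest 2∣u = ∣m+n∣m⇒∣n (subst (2 ∣_) (sym (m+[n∸m]≡n u≤L)) 2∣L) 2∣u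
... | q , H , q≤z , H≤P , qH with split-≤ H≤P
... | h₁ , H′ , h₁≤ , H′≤ , e₁ with split-≤ H′≤
... | h₂ , h₃ , h₂≤ , h₃≤ , e₂ =
  u +ᵐ pairs q h₁ h₂ h₃ , +ᵐ-mono-≤ᵐ u≤R (q≤z , h₁≤ , h₂≤ , h₃≤ , h₁≤ , h₂≤ , h₃≤) ,
  Balanced-+ᵐ u (pairs q h₁ h₂ h₃) bu refl , size-L
  where
  open ≡-Reasoning
  size-L : size (u +ᵐ pairs q h₁ h₂ h₃) ≡ L
  size-L = begin
    size (u +ᵐ pairs q h₁ h₂ h₃)
      ≡⟨ size-+ᵐ u (pairs q h₁ h₂ h₃) ⟩
    size u + (q + ((h₁ + (h₂ + h₃)) + (h₁ + (h₂ + h₃))))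
      ≡⟨ cong (λ h → size u + (q + (h + h))) (trans (cong (_+_ h₁) e₂) e₁) ⟩
    size u + (q + (H + H))
      ≡⟨ cong (_+_ (size u)) qH ⟩
    size u + (L ∸ size u)
      ≡⟨ m+[n∸m]≡n u≤L ⟩
    L ∎

part-from-residues : ∀ {k L K} → 2 ∣ L → ResidueSolver k L K → HasBalancedParts k L K
part-from-residues {K = K} 2∣L solve {n} sn bn K≤ with decompose n
... | R , z , p₁ , p₂ , p₃ , one , refl =
  completion⇒part 2∣L (solve (Supported-≤ (≤ᵐ-+ᵐ R (pairs z p₁ p₂ p₃)) sn) one
                             (Balanced-cancelʳ R (pairs z p₁ p₂ p₃) refl bn)
                             (subst (K ≤_) (size-+ᵐ R (pairs z p₁ p₂ p₃)) K≤))

completable-mirror : ∀ {L R z P} → Completable L R z P → Completable L (mirror R) z P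
completable-mirror {L} {z = z} {P} (completion u u≤R bu u≤L L≤ parity) =
  completion (mirror u) (mirror-mono-≤ᵐ u≤R) (sym bu)
    (subst (_≤ L) (sym (size-mirror u)) u≤L)
    (subst (λ m → L ≤ m + (z + (P + P))) (sym (size-mirror u)) L≤)
    (subst (λ m → 0 < z ⊎ 2 ∣ m) (sym (size-mirror u)) parity)

completable-exact : ∀ {L R z P} u → u ≤ᵐ R → Balanced u → size u ≡ L → 2 ∣ L →
                    Completable L R z P
completable-exact {z = z} {P} u u≤R bu refl 2∣L =
  completion u u≤R bu ≤-refl (m≤m+n (size u) (z + (P + P))) (inj₂ 2∣L)

completable-empty : ∀ {L K R z P} → size R ≡ 0 → L ≤ K → K ≤ size R + (z + (P + P)) →
                    Completable L R z P
completable-empty {K = K} {z = z} {P = P} size≡0 L≤K K≤ =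
  completion (mk 0 0 0 0 0 0 0) (z≤n , z≤n , z≤n , z≤n , z≤n , z≤n , z≤n) refl z≤n
    (≤-trans L≤K (subst (λ m → K ≤ m + (z + (P + P))) size≡0 K≤)) (inj₂ (divides 0 refl))

-- Certified finite search

-- A lower bound for the padding z + (P + P) that uses only K ≤ size R + (z + (P + P)) and
-- whether z is positive: without zeros the padding is even.
capacity : Bool → ℕ → ℕ
capacity true  m = m
capacity false m = ⌈ m /2⌉ + ⌈ m /2⌉

capacity-≤ : ∀ K R z P → K ≤ size R + (z + (P + P)) →
             capacity (0 <ᵇ z) (K ∸ size R) ≤ z + (P + P)
capacity-≤ K R zero P K≤ = +-mono-≤ half≤P half≤P
  where
  half≤P : ⌈ K ∸ size R /2⌉ ≤ P
  half≤P = subst (⌈ K ∸ size R /2⌉ ≤_) (sym (n≡⌈n+n/2⌉ P))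
                 (⌈n/2⌉-mono (m≤n+o⇒m∸n≤o K (size R) K≤))
capacity-≤ K R (suc z) P K≤ = m≤n+o⇒m∸n≤o K (size R) K≤

_≤ᵐᵇ_ : Mult → Mult → Bool
u ≤ᵐᵇ v = (m₀ u ≤ᵇ m₀ v) ∧ (m₁ u ≤ᵇ m₁ v) ∧ (m₂ u ≤ᵇ m₂ v) ∧ (m₃ u ≤ᵇ m₃ v) ∧
          (m₋₁ u ≤ᵇ m₋₁ v) ∧ (m₋₂ u ≤ᵇ m₋₂ v) ∧ (m₋₃ u ≤ᵇ m₋₃ v)

T-∧⁻ : ∀ {a b} → T (a ∧ b) → T a × T b
T-∧⁻ = Equivalence.to T-∧

≤ᵐᵇ-sound : ∀ u v → T (u ≤ᵐᵇ v) → u ≤ᵐ v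
≤ᵐᵇ-sound u v t₀ =
  let l₀ , t₁ = T-∧⁻ t₀
      l₁ , t₂ = T-∧⁻ t₁
      l₂ , t₃ = T-∧⁻ t₂
      l₃ , t₄ = T-∧⁻ t₃
      l₄ , t₅ = T-∧⁻ t₄
      l₅ , l₆ = T-∧⁻ t₅
  in ≤ᵇ⇒≤ _ _ l₀ , ≤ᵇ⇒≤ _ _ l₁ , ≤ᵇ⇒≤ _ _ l₂ , ≤ᵇ⇒≤ _ _ l₃ ,
     ≤ᵇ⇒≤ _ _ l₄ , ≤ᵇ⇒≤ _ _ l₅ , ≤ᵇ⇒≤ _ _ l₆

fitsᵇ : ℕ → ℕ → Bool → ℕ → Bool
fitsᵇ L W b s = (s ≤ᵇ L) ∧ (L ≤ᵇ s + W) ∧ (b ∨ (s % 2 ≡ᵇ 0))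

admissibleᵇ : ℕ → ℕ → Bool → Mult → Mult → Bool
admissibleᵇ L K b R u =
  (u ≤ᵐᵇ R) ∧ (weight⁺ u ≡ᵇ weight⁻ u) ∧ fitsᵇ L (capacity b (K ∸ size R)) b (size u)

admissibleᵇ-sound : ∀ L K R z P u → T (admissibleᵇ L K (0 <ᵇ z) R u) →
                    K ≤ size R + (z + (P + P)) → Completable L R z P
admissibleᵇ-sound L K R z P u t₀ K≤ =
  let u≤R , t₁    = T-∧⁻ t₀
      bu  , t₂    = T-∧⁻ t₁
      u≤L , t₃    = T-∧⁻ t₂
      L≤  , parity = T-∧⁻ t₃
  in completion u (≤ᵐᵇ-sound u R u≤R) (≡ᵇ⇒≡ _ _ bu) (≤ᵇ⇒≤ _ _ u≤L)
       (≤-trans (≤ᵇ⇒≤ _ _ L≤) (+-monoʳ-≤ (size u) (capacity-≤ K R z P K≤)))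
       (Sum.map (<ᵇ⇒< 0 z) (λ even → m%n≡0⇒n∣m (size u) 2 (≡ᵇ⇒≡ _ _ even))
                (Equivalence.to T-∨ parity))

searchᵇ : ℕ → ℕ → Bool → Mult → List Mult → Bool
searchᵇ L K b R us = any (admissibleᵇ L K b R) us

search-sound : ∀ L K R z P us → T (searchᵇ L K (0 <ᵇ z) R us) → K ≤ size R + (z + (P + P)) →
               Completable L R z P
search-sound L K R z P us found K≤
  with u , ok ← satisfied (any⁻ (admissibleᵇ L K (0 <ᵇ z) R) us found) =
  admissibleᵇ-sound L K R z P u ok K≤

all≤ : ℕ → (ℕ → Bool) → Bool
all≤ n p = all p (downFrom (suc n))

all≤-sound : ∀ {n p i} → T (all≤ n p) → i ≤ n → T (p i)
all≤-sound {n} {p} holds i≤n =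
  All.lookup (AllP.all⁺ p (downFrom (suc n)) holds) (∈-downFrom⁺ (s≤s i≤n))

tableᵇ : ℕ → ℕ → (ℕ → ℕ → ℕ → Mult) → (ℕ → ℕ → ℕ → List Mult) → ℕ → ℕ → ℕ → Bool
tableᵇ L K R us n₁ n₂ n₃ =
  all≤ n₁ λ i → all≤ n₂ λ j → all≤ n₃ λ k →
    not (weight⁺ (R i j k) ≡ᵇ weight⁻ (R i j k)) ∨
    (searchᵇ L K true (R i j k) (us i j k) ∧ searchᵇ L K false (R i j k) (us i j k))

table-sound : ∀ L K R us n₁ n₂ n₃ {i j k z P} → T (tableᵇ L K R us n₁ n₂ n₃) →
  i ≤ n₁ → j ≤ n₂ → k ≤ n₃ → Balanced (R i j k) → K ≤ size (R i j k) + (z + (P + P)) →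
  Completable L (R i j k) z P
table-sound L K R us n₁ n₂ n₃ {i} {j} {k} {z} {P} holds i≤ j≤ k≤ bal K≤ =
  by-zeros z (entry (all≤-sound (all≤-sound (all≤-sound holds i≤) j≤) k≤) (≡⇒≡ᵇ _ _ bal)) K≤
  where
  entry : ∀ {a b} → T (not a ∨ b) → T a → T b
  entry {true} t _ = t
  by-zeros : ∀ z →
    T (searchᵇ L K true (R i j k) (us i j k) ∧ searchᵇ L K false (R i j k) (us i j k)) →
    K ≤ size (R i j k) + (z + (P + P)) → Completable L (R i j k) z P
  by-zeros zero    found = search-sound L K (R i j k) zero P (us i j k) (proj₂ (T-∧⁻ found))
  by-zeros (suc z) found = search-sound L K (R i j k) (suc z) P (us i j k) (proj₁ (T-∧⁻ found))

R⁻ : ℕ → ℕ → ℕ → Mult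
R⁻ s₁ s₂ s₃ = mk 0 0 0 0 s₁ s₂ s₃

completable-R⁻ : ∀ {L K s₁ s₂ s₃ z P} → L ≤ K → Balanced (R⁻ s₁ s₂ s₃) →
                 K ≤ size (R⁻ s₁ s₂ s₃) + (z + (P + P)) → Completable L (R⁻ s₁ s₂ s₃) z P
completable-R⁻ {s₁ = s₁} {s₂} {s₃} L≤K bal = completable-empty empty L≤K
  where
  empty : s₁ + (s₂ + s₃) ≡ 0
  empty = n≤0⇒n≡0 (≤-trans (+-monoʳ-≤ s₁ (+-mono-≤ (m≤n*m s₂ 2) (m≤n*m s₃ 3)))
                           (≤-reflexive (sym bal)))

mirrored : ∀ {L K R z P} → (Balanced R → K ≤ size R + (z + (P + P)) → Completable L R z P) →
           Balanced (mirror R) → K ≤ size (mirror R) + (z + (P + P)) → Completable L (mirror R) z P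
mirrored {K = K} {R} {z} {P} complete bal K≤ =
  completable-mirror (complete (sym bal) (subst (λ m → K ≤ m + (z + (P + P))) (size-mirror R) K≤))

Rᴬ : ℕ → ℕ → ℕ → Mult
Rᴬ a b c = mk 0 0 0 a b c 0

-- x threes, w minus twos and 3x − 2w minus ones, of size 4x − w: w is the least value keeping
-- the size at most L and the number of minus ones at most b, or one more.
candidatesᴬ : ℕ → ℕ → ℕ → ℕ → List Mult
candidatesᴬ L a b c =
  concatMap (λ x → candidate x (w x) ∷ candidate x (suc (w x)) ∷ []) (downFrom (suc a))
  where
  candidate : ℕ → ℕ → Mult
  candidate x w = mk 0 0 0 x (3 * x ∸ 2 * w) w 0
  w : ℕ → ℕ
  w x = (4 * x ∸ L) ⊔ ⌈ 3 * x ∸ b /2⌉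

tableᴬ : T (tableᵇ 60 66 Rᴬ (candidatesᴬ 60) 38 44 35)
tableᴬ = tt

-- A residue with many entries of one kind contains an explicit balanced part of size 60;
-- the remaining residues are bounded and covered by the table.
completableᴬ-60 : ∀ {a b c z P} → Balanced (Rᴬ a b c) → 66 ≤ size (Rᴬ a b c) + (z + (P + P)) →
                  Completable 60 (Rᴬ a b c) z P
completableᴬ-60 {a} {b} {c} bal K≤ with 45 ≤? b | 36 ≤? c
... | yes 45≤b | _ =
  completable-exact (mk 0 0 0 15 45 0 0) (z≤n , z≤n , z≤n , 15≤a , 45≤b , z≤n , z≤n)
                    refl refl (divides 30 refl)
  where
  15≤a : 15 ≤ a
  15≤a = *-cancelˡ-≤ 3 (≤-trans 45≤b (≤-trans (m≤m+n b _) (≤-reflexive (sym bal))))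
... | no _ | yes 36≤c =
  completable-exact (mk 0 0 0 24 0 36 0) (z≤n , z≤n , z≤n , 24≤a , z≤n , 36≤c , z≤n)
                    refl refl (divides 30 refl)
  where
  24≤a : 24 ≤ a
  24≤a = *-cancelˡ-≤ 3 (≤-trans (+-monoˡ-≤ 0 (*-monoʳ-≤ 2 36≤c))
                                (≤-trans (m≤n+m _ b) (≤-reflexive (sym bal))))
... | no 45≰b | no 36≰c =
  table-sound 60 66 Rᴬ (candidatesᴬ 60) 38 44 35 tableᴬ a≤38 (≮⇒≥ 45≰b) (≮⇒≥ 36≰c) bal K≤
  where
  a≤38 : a ≤ 38
  a≤38 = *-cancelˡ-≤ 3 (≤-trans (≤-reflexive bal)
           (+-mono-≤ (≮⇒≥ 45≰b) (+-monoˡ-≤ 0 (*-monoʳ-≤ 2 (≮⇒≥ 36≰c)))))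

Rᴮ : ℕ → ℕ → ℕ → Mult
Rᴮ y₂ y₃ m = mk 0 0 y₂ y₃ m 0 0

-- x₂ twos, x₃ threes and 2x₂ + 3x₃ minus ones, of size 3x₂ + 4x₃: x₂ is the largest value
-- keeping the size at most L, or one less.
candidatesᴮ : ℕ → ℕ → ℕ → ℕ → List Mult
candidatesᴮ L y₂ y₃ m =
  concatMap (λ x₃ → candidate (x₂ x₃) x₃ ∷ candidate (x₂ x₃ ∸ 1) x₃ ∷ []) (downFrom (suc y₃))
  where
  candidate : ℕ → ℕ → Mult
  candidate x₂ x₃ = mk 0 0 x₂ x₃ (2 * x₂ + 3 * x₃) 0 0
  x₂ : ℕ → ℕ
  x₂ x₃ = y₂ ⊓ ((L ∸ 4 * x₃) / 3)

tableᴮ : T (tableᵇ 60 66 Rᴮ (candidatesᴮ 60) 19 14 80)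
tableᴮ = tt

completableᴮ-60 : ∀ {y₂ y₃ m z P} → Balanced (Rᴮ y₂ y₃ m) →
                  66 ≤ size (Rᴮ y₂ y₃ m) + (z + (P + P)) → Completable 60 (Rᴮ y₂ y₃ m) z P
completableᴮ-60 {y₂} {y₃} {m} bal K≤ with 15 ≤? y₃ | 20 ≤? y₂
... | yes 15≤y₃ | _ =
  completable-exact (mk 0 0 0 15 45 0 0) (z≤n , z≤n , z≤n , 15≤y₃ , 45≤m , z≤n , z≤n)
                    refl refl (divides 30 refl)
  where
  45≤m : 45 ≤ m
  45≤m = ≤-trans (*-monoʳ-≤ 3 15≤y₃)
                 (≤-trans (m≤n+m _ (2 * y₂)) (≤-reflexive (trans bal (+-identityʳ m))))
... | no _ | yes 20≤y₂ =
  completable-exact (mk 0 0 20 0 40 0 0) (z≤n , z≤n , 20≤y₂ , z≤n , 40≤m , z≤n , z≤n)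
                    refl refl (divides 30 refl)
  where
  40≤m : 40 ≤ m
  40≤m = ≤-trans (*-monoʳ-≤ 2 20≤y₂)
                 (≤-trans (m≤m+n _ (3 * y₃)) (≤-reflexive (trans bal (+-identityʳ m))))
... | no 15≰y₃ | no 20≰y₂ =
  table-sound 60 66 Rᴮ (candidatesᴮ 60) 19 14 80 tableᴮ (≮⇒≥ 20≰y₂) (≮⇒≥ 15≰y₃) m≤80 bal K≤
  where
  m≤80 : m ≤ 80
  m≤80 = ≤-trans (≤-reflexive (sym (trans bal (+-identityʳ m))))
           (+-mono-≤ (*-monoʳ-≤ 2 (≮⇒≥ 20≰y₂)) (*-monoʳ-≤ 3 (≮⇒≥ 15≰y₃)))

tableᴮ-6 : T (tableᵇ 6 8 Rᴮ (candidatesᴮ 6) 1 0 2)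
tableᴮ-6 = tt

completableᴮ-6 : ∀ {y m z P} → Balanced (Rᴮ y 0 m) → 8 ≤ size (Rᴮ y 0 m) + (z + (P + P)) →
                 Completable 6 (Rᴮ y 0 m) z P
completableᴮ-6 {y} {m} bal K≤ with 2 ≤? y
... | yes 2≤y =
  completable-exact (mk 0 0 2 0 4 0 0) (z≤n , z≤n , 2≤y , z≤n , 4≤m , z≤n , z≤n)
                    refl refl (divides 3 refl)
  where
  4≤m : 4 ≤ m
  4≤m = ≤-trans (*-monoʳ-≤ 2 2≤y) (≤-trans (m≤m+n _ 0) (≤-reflexive (trans bal (+-identityʳ m))))
... | no 2≰y = table-sound 6 8 Rᴮ (candidatesᴮ 6) 1 0 2 tableᴮ-6 (≮⇒≥ 2≰y) z≤n m≤2 bal K≤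
  where
  m≤2 : m ≤ 2
  m≤2 = ≤-trans (≤-reflexive (sym (trans bal (+-identityʳ m))))
                (+-monoˡ-≤ 0 (*-monoʳ-≤ 2 (≮⇒≥ 2≰y)))

Rᶜ : ℕ → ℕ → ℕ → Mult
Rᶜ a b c = mk 0 a 0 b 0 c 0

-- x ones, y threes and ⌊(x + 3y)/2⌋ minus twos, of size about (3x + 5y)/2: x is the largest value
-- keeping the size at most L, or up to three less.
candidatesᶜ : ℕ → ℕ → ℕ → ℕ → List Mult
candidatesᶜ L a b c =
  concatMap (λ y → map (λ d → candidate (x y ∸ d) y) (0 ∷ 1 ∷ 2 ∷ 3 ∷ [])) (downFrom (suc b))
  where
  candidate : ℕ → ℕ → Mult
  candidate x y = mk 0 x 0 y 0 ⌊ x + 3 * y /2⌋ 0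
  x : ℕ → ℕ
  x y = a ⊓ ((2 * L ∸ 5 * y) / 3)

tableᶜ : T (tableᵇ 60 66 Rᶜ (candidatesᶜ 60) 39 23 54)
tableᶜ = tt

completableᶜ-60 : ∀ {a b c z P} → Balanced (Rᶜ a b c) → 66 ≤ size (Rᶜ a b c) + (z + (P + P)) →
                  Completable 60 (Rᶜ a b c) z P
completableᶜ-60 {a} {b} {c} bal K≤ with 40 ≤? a | 24 ≤? b
... | yes 40≤a | _ =
  completable-exact (mk 0 40 0 0 0 20 0) (z≤n , 40≤a , z≤n , z≤n , z≤n , 20≤c , z≤n)
                    refl refl (divides 30 refl)
  where
  20≤c : 20 ≤ c
  20≤c = *-cancelˡ-≤ 2 (≤-trans 40≤a (≤-trans (m≤m+n a _) (≤-reflexive (trans bal (+-identityʳ _)))))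
... | no _ | yes 24≤b =
  completable-exact (mk 0 0 0 24 0 36 0) (z≤n , z≤n , z≤n , 24≤b , z≤n , 36≤c , z≤n)
                    refl refl (divides 30 refl)
  where
  36≤c : 36 ≤ c
  36≤c = *-cancelˡ-≤ 2 (≤-trans (*-monoʳ-≤ 3 24≤b)
                                (≤-trans (m≤n+m _ a) (≤-reflexive (trans bal (+-identityʳ _)))))
... | no 40≰a | no 24≰b =
  table-sound 60 66 Rᶜ (candidatesᶜ 60) 39 23 54 tableᶜ (≮⇒≥ 40≰a) (≮⇒≥ 24≰b) c≤54 bal K≤
  where
  c≤54 : c ≤ 54
  c≤54 = *-cancelˡ-≤ 2 (≤-trans (≤-reflexive (sym (trans bal (+-identityʳ _))))
           (+-mono-≤ (≮⇒≥ 40≰a) (*-monoʳ-≤ 3 (≮⇒≥ 24≰b))))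

residueSolver₁ : ResidueSolver 1 2 2
residueSolver₁ {mk _ r₁ r₂ r₃ s₁ s₂ s₃} sR (refl , o₁ , _)
  with sR (+ 2) (+∉I ≤-refl) | sR -[1+ 1 ] (-∉I ≤-refl)
     | sR (+ 3) (+∉I (s≤s (s≤s z≤n))) | sR -[1+ 2 ] (-∉I (s≤s z≤n))
residueSolver₁ sR (refl , inj₁ refl , _) | refl | refl | refl | refl =
  completable-R⁻ ≤-refl
residueSolver₁ sR (refl , inj₂ refl , _) | refl | refl | refl | refl =
  mirrored {R = R⁻ _ 0 0} (completable-R⁻ ≤-refl)

residueSolver₂ : ResidueSolver 2 6 8
residueSolver₂ {mk _ r₁ r₂ r₃ s₁ s₂ s₃} sR (refl , o₁ , o₂ , _)
  with sR (+ 3) (+∉I ≤-refl) | sR -[1+ 2 ] (-∉I ≤-refl)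
residueSolver₂ sR (refl , inj₁ refl , inj₁ refl , _) | refl | refl =
  completable-R⁻ (m≤m+n 6 2)
residueSolver₂ sR (refl , inj₂ refl , inj₂ refl , _) | refl | refl =
  mirrored {R = R⁻ _ _ 0} (completable-R⁻ (m≤m+n 6 2))
residueSolver₂ sR (refl , inj₁ refl , inj₂ refl , _) | refl | refl = completableᴮ-6
residueSolver₂ sR (refl , inj₂ refl , inj₁ refl , _) | refl | refl =
  mirrored {R = Rᴮ _ 0 _} completableᴮ-6

residueSolver₃ : ResidueSolver 3 60 66
residueSolver₃ _ (refl , inj₁ refl , inj₁ refl , inj₁ refl) = completable-R⁻ (m≤m+n 60 6)
residueSolver₃ _ (refl , inj₂ refl , inj₂ refl , inj₂ refl) =
  mirrored {R = R⁻ _ _ _} (completable-R⁻ (m≤m+n 60 6))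
residueSolver₃ _ (refl , inj₁ refl , inj₁ refl , inj₂ refl) = completableᴬ-60
residueSolver₃ _ (refl , inj₂ refl , inj₂ refl , inj₁ refl) = mirrored {R = Rᴬ _ _ _} completableᴬ-60
residueSolver₃ _ (refl , inj₁ refl , inj₂ refl , inj₂ refl) = completableᴮ-60
residueSolver₃ _ (refl , inj₂ refl , inj₁ refl , inj₁ refl) = mirrored {R = Rᴮ _ _ _} completableᴮ-60
residueSolver₃ _ (refl , inj₂ refl , inj₁ refl , inj₂ refl) = completableᶜ-60
residueSolver₃ _ (refl , inj₁ refl , inj₂ refl , inj₁ refl) = mirrored {R = Rᶜ _ _ _} completableᶜ-60

balancedPart-I₁ : HasBalancedParts 1 2 (2 + 0)
balancedPart-I₁ = part-from-residues (divides 1 refl) residueSolver₁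

balancedPart-I₂ : HasBalancedParts 2 6 (6 + 2)
balancedPart-I₂ = part-from-residues (divides 3 refl) residueSolver₂

balancedPart-I₃ : HasBalancedParts 3 60 (60 + 6)
balancedPart-I₃ = part-from-residues (divides 30 refl) residueSolver₃

-- Necessity of the divisibility conditions

2∣-of-Prop-s' : ∀ {k t ℓ} → 1 ≤ k → Prop-s' k t ℓ → 2 ∣ t
2∣-of-Prop-s' {k} {t} {ℓ} 1≤k P =
  from-part (balancedPart-of-listing c over refl (≤-trans (m≤m+n ℓ 0) (m≤m+n _ _)) P)
  where
  c = mk 0 ℓ 0 0 ℓ 0 0
  over : All (InI k) (listing c)
  over = AllP.++⁺ (AllP.replicate⁺ ℓ (+∈I 1≤k)) (AllP.++⁺ (AllP.replicate⁺ ℓ (-∈I 1≤k)) [])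
  double : ∀ x → (x + 0) + (x + 0) ≡ x * 2
  double = solve-∀
  from-part : BalancedPart c t → 2 ∣ t
  from-part (mk _ x _ _ y _ _ , (z≤n , _ , z≤n , z≤n , _ , z≤n , z≤n) , bal , size≡t) =
    divides x (trans (sym size≡t) (trans (cong (λ w → (x + 0) + w) (sym bal)) (double x)))

3∣-of-Prop-s' : ∀ {k t ℓ} → 2 ≤ k → Prop-s' k t ℓ → 3 ∣ t
3∣-of-Prop-s' {k} {t} {ℓ} 2≤k P =
  from-part (balancedPart-of-listing c over refl (≤-trans (m≤m+n ℓ 0) (m≤m+n _ _)) P)
  where
  c = mk 0 0 ℓ 0 (2 * ℓ) 0 0
  over : All (InI k) (listing c)
  over = AllP.++⁺ (AllP.replicate⁺ ℓ (+∈I 2≤k))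
                  (AllP.++⁺ (AllP.replicate⁺ (2 * ℓ) (-∈I (≤-trans (s≤s z≤n) 2≤k))) [])
  triple : ∀ x → (x + 0) + (2 * x + 0) ≡ x * 3
  triple = solve-∀
  from-part : BalancedPart c t → 3 ∣ t
  from-part (mk _ _ x _ y _ _ , (z≤n , z≤n , _ , z≤n , _ , z≤n , z≤n) , bal , size≡t) =
    divides x (trans (sym size≡t) (trans (cong (λ w → (x + 0) + w) (sym bal)) (triple x)))

4∣-of-Prop-s' : ∀ {k t ℓ} → 3 ≤ k → Prop-s' k t ℓ → 4 ∣ t
4∣-of-Prop-s' {k} {t} {ℓ} 3≤k P =
  from-part (balancedPart-of-listing c (All.map (I-mono 3≤k) (listing-I₃ c)) (sym (+-identityʳ _))
                                     (m≤m+n ℓ _) P)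
  where
  c = mk 0 0 0 ℓ (3 * ℓ) 0 0
  quadruple : ∀ x → x + 3 * x ≡ x * 4
  quadruple = solve-∀
  from-part : BalancedPart c t → 4 ∣ t
  from-part (mk _ _ _ x y _ _ , (z≤n , z≤n , z≤n , _ , _ , z≤n , z≤n) , bal , size≡t) =
    divides x (trans (sym size≡t) (trans (cong (λ w → x + w) (sym bal)) (quadruple x)))

5∣-of-Prop-s' : ∀ {k t ℓ} → 3 ≤ k → Prop-s' k t ℓ → 5 ∣ t
5∣-of-Prop-s' {k} {t} {ℓ} 3≤k P =
  from-part (balancedPart-of-listing c (All.map (I-mono 3≤k) (listing-I₃ c)) (balanced ℓ)
                                     (≤-trans (m≤m+n ℓ _) (m≤m+n _ _)) P)
  where
  c = mk 0 0 0 (2 * ℓ) 0 (3 * ℓ) 0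
  balanced : ∀ ℓ → 3 * (2 * ℓ) ≡ 2 * (3 * ℓ) + 0
  balanced = solve-∀
  distrib : ∀ x w → 2 * (x + (w + 0)) ≡ 2 * x + (2 * w + 0)
  distrib = solve-∀
  quintuple : ∀ x → 2 * x + 3 * x ≡ x * 5
  quintuple = solve-∀
  from-part : BalancedPart c t → 5 ∣ t
  from-part (mk _ _ _ x _ w _ , (z≤n , z≤n , z≤n , _ , z≤n , _ , z≤n) , bal , size≡t) =
    coprime-divisor (toWitness {a? = coprime? 5 2} tt) (divides x (begin
      2 * t                   ≡⟨ cong (2 *_) size≡t ⟨
      2 * (x + (w + 0))       ≡⟨ distrib x w ⟩
      2 * x + (2 * w + 0)     ≡⟨ cong (_+_ (2 * x)) bal ⟨
      2 * x + 3 * x           ≡⟨ quintuple x ⟩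
      x * 5                   ∎))
    where open ≡-Reasoning

-- Minimality

¬Prop-s'-zeros : ∀ {k t m} → m ≤ t → ¬ Prop-s' k (suc t) m
¬Prop-s'-zeros {k} {t} {m} m≤t P =
  too-long (balancedPart-of-listing c over refl (subst (m ≤_) (sym (+-identityʳ t)) m≤t) P)
  where
  c = mk t 0 0 0 0 0 0
  over : All (InI k) (listing c)
  over = AllP.++⁺ (AllP.replicate⁺ t (+∈I z≤n)) []
  too-long : ¬ BalancedPart c (suc t)
  too-long (u , u≤c , _ , size≡) =
    1+n≰n (≤-trans (≤-reflexive (sym size≡)) (≤-trans (size-mono u≤c) (≤-reflexive (+-identityʳ t))))

minimal₂ : ∀ {k} j {m} → m < suc j * 2 + 0 → ¬ Prop-s' k (suc j * 2) m
minimal₂ j {m} m< = ¬Prop-s'-zeros (subst (m ≤_) (+-identityʳ _) (s≤s⁻¹ m<))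

2x+3y≢6[1+j] : ∀ j x y → x ≤ 3 * j + 2 → y ≤ 1 → 2 * x + 3 * y ≢ suc j * 6
2x+3y≢6[1+j] j x zero x≤ _ e =
  1+n≰n (+-cancelˡ-≤ (3 * j) 3 2 (subst (_≤ 3 * j + 2) x≡ x≤))
  where
  six : ∀ j → suc j * 6 ≡ 2 * (3 * j + 3)
  six = solve-∀
  x≡ : x ≡ 3 * j + 3
  x≡ = *-cancelˡ-≡ x (3 * j + 3) 2 (trans (sym (+-identityʳ _)) (trans e (six j)))
2x+3y≢6[1+j] j x (suc zero) _ _ e =
  toWitnessFalse {a? = 2 ∣? 3} tt
    (∣m+n∣m⇒∣n (subst (2 ∣_) (sym e) (divides (suc j * 3) (six j))) (m∣m*n x))
  where
  six : ∀ j → suc j * 6 ≡ suc j * 3 * 2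
  six = solve-∀
2x+3y≢6[1+j] j x (suc (suc _)) _ (s≤s ()) _

minimal₆ : ∀ {k} → 2 ≤ k → ∀ j {m} → m < suc j * 6 + 2 → ¬ Prop-s' k (suc j * 6) m
minimal₆ {k} 2≤k j {m} m< P =
  no-part (balancedPart-of-listing c over (balanced j) (s≤s⁻¹ (subst (m <_) (sym (size-c j)) m<)) P)
  where
  c = mk 0 (3 * j + 2) 1 0 (3 * j + 4) 0 0
  1≤k = ≤-trans (s≤s z≤n) 2≤k
  over : All (InI k) (listing c)
  over = AllP.++⁺ (AllP.replicate⁺ (3 * j + 2) (+∈I 1≤k))
           (+∈I 2≤k ∷ AllP.++⁺ (AllP.replicate⁺ (3 * j + 4) (-∈I 1≤k)) [])
  balanced : ∀ j → (3 * j + 2) + 2 ≡ (3 * j + 4) + 0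
  balanced = solve-∀
  size-c : ∀ j → suc (((3 * j + 2) + 1) + ((3 * j + 4) + 0)) ≡ suc j * 6 + 2
  size-c = solve-∀
  weights : ∀ x₁ x₂ y → x₁ + (2 * x₂ + 0) ≡ y + 0 → (x₁ + (x₂ + 0)) + (y + 0) ≡ 2 * x₁ + 3 * x₂
  weights x₁ x₂ y bal = trans (cong (_+_ (x₁ + (x₂ + 0))) (sym bal)) (total x₁ x₂)
    where
    total : ∀ x₁ x₂ → (x₁ + (x₂ + 0)) + (x₁ + (2 * x₂ + 0)) ≡ 2 * x₁ + 3 * x₂
    total = solve-∀
  no-part : ¬ BalancedPart c (suc j * 6)
  no-part (mk _ x₁ x₂ _ y _ _ , (z≤n , x₁≤ , x₂≤ , z≤n , _ , z≤n , z≤n) , bal , size≡) =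
    2x+3y≢6[1+j] j x₁ x₂ x₁≤ x₂≤ (trans (sym (weights x₁ x₂ y bal)) size≡)

4x+3y≢60[1+j] : ∀ j x y → x ≤ 15 * j + 14 → y ≤ 3 → 4 * x + 3 * y ≢ suc j * 60
4x+3y≢60[1+j] j x zero x≤ _ e =
  1+n≰n (+-cancelˡ-≤ (15 * j) 15 14 (subst (_≤ 15 * j + 14) x≡ x≤))
  where
  sixty : ∀ j → suc j * 60 ≡ 4 * (15 * j + 15)
  sixty = solve-∀
  x≡ : x ≡ 15 * j + 15
  x≡ = *-cancelˡ-≡ x (15 * j + 15) 4 (trans (sym (+-identityʳ _)) (trans e (sixty j)))
4x+3y≢60[1+j] j x (suc y) _ y≤ e =
  4∤3[1+y] y (s≤s⁻¹ y≤) (∣m+n∣m⇒∣n (subst (4 ∣_) (sym e) (divides (suc j * 15) (sixty j))) (m∣m*n x))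
  where
  sixty : ∀ j → suc j * 60 ≡ suc j * 15 * 4
  sixty = solve-∀
  4∤3[1+y] : ∀ y → y ≤ 2 → ¬ 4 ∣ 3 * suc y
  4∤3[1+y] zero                _ = toWitnessFalse {a? = 4 ∣? 3} tt
  4∤3[1+y] (suc zero)          _ = toWitnessFalse {a? = 4 ∣? 6} tt
  4∤3[1+y] (suc (suc zero))    _ = toWitnessFalse {a? = 4 ∣? 9} tt
  4∤3[1+y] (suc (suc (suc _))) (s≤s (s≤s ()))

minimal₆₀ : ∀ {k} → 3 ≤ k → ∀ j {m} → m < suc j * 60 + 6 → ¬ Prop-s' k (suc j * 60) m
minimal₆₀ {k} 3≤k j {m} m< P =
  no-part (balancedPart-of-listing c (All.map (I-mono 3≤k) (listing-I₃ c)) (balanced j)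
             (s≤s⁻¹ (subst (m <_) (sym (size-c j)) m<)) P)
  where
  c = mk 0 0 3 (15 * j + 14) (45 * j + 48) 0 0
  balanced : ∀ j → 6 + 3 * (15 * j + 14) ≡ (45 * j + 48) + 0
  balanced = solve-∀
  size-c : ∀ j → suc ((3 + (15 * j + 14)) + ((45 * j + 48) + 0)) ≡ suc j * 60 + 6
  size-c = solve-∀
  weights : ∀ x₂ x₃ y → 2 * x₂ + 3 * x₃ ≡ y + 0 → (x₂ + x₃) + (y + 0) ≡ 4 * x₃ + 3 * x₂
  weights x₂ x₃ y bal = trans (cong (_+_ (x₂ + x₃)) (sym bal)) (total x₂ x₃)
    where
    total : ∀ x₂ x₃ → (x₂ + x₃) + (2 * x₂ + 3 * x₃) ≡ 4 * x₃ + 3 * x₂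
    total = solve-∀
  no-part : ¬ BalancedPart c (suc j * 60)
  no-part (mk _ _ x₂ x₃ y _ _ , (z≤n , z≤n , x₂≤ , x₃≤ , _ , z≤n , z≤n) , bal , size≡) =
    4x+3y≢60[1+j] j x₃ x₂ x₃≤ x₂≤ (trans (sym (weights x₂ x₃ y bal)) size≡)

s'-of-multiple : ∀ {k L s} → k ≤ 3 → HasBalancedParts k L (L + s) →
  (∀ j {m} → m < suc j * L + s → ¬ Prop-s' k (suc j * L) m) →
  ∀ {t} → 1 ≤ t → L ∣ t → s'≡ k t (t + s)
s'-of-multiple k≤3 parts minimal () (divides zero refl)
s'-of-multiple {s = s} k≤3 parts minimal 1≤t (divides (suc j) refl) =
  ≤-trans 1≤t (m≤m+n _ s) , Prop-s'-of-parts k≤3 (iterate-parts parts (suc j)) , λ _ _ → minimal j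

small-divisors : ∀ {k t ℓ} → k ≡ 1 ⊎ k ≡ 2 ⊎ k ≡ 3 → Prop-s' k t ℓ →
                 ∀ d → 1 ≤ d → d ≤ D k → d ∣ t
small-divisors _                  _ 1 _ _ = 1∣ _
small-divisors (inj₁ refl)        P 2 _ _ = 2∣-of-Prop-s' ≤-refl P
small-divisors (inj₂ (inj₁ refl)) P 2 _ _ = 2∣-of-Prop-s' (s≤s z≤n) P
small-divisors (inj₂ (inj₂ refl)) P 2 _ _ = 2∣-of-Prop-s' (s≤s z≤n) P
small-divisors (inj₂ (inj₁ refl)) P 3 _ _ = 3∣-of-Prop-s' ≤-refl P
small-divisors (inj₂ (inj₂ refl)) P 3 _ _ = 3∣-of-Prop-s' (s≤s (s≤s z≤n)) P
small-divisors (inj₂ (inj₂ refl)) P 4 _ _ = 4∣-of-Prop-s' ≤-refl P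
small-divisors (inj₂ (inj₂ refl)) P 5 _ _ = 5∣-of-Prop-s' ≤-refl P
small-divisors _                  _ 0 () _
small-divisors (inj₁ refl)        _ (suc (suc (suc _))) _ (s≤s (s≤s ()))
small-divisors (inj₂ (inj₁ refl)) _ (suc (suc (suc (suc _)))) _ (s≤s (s≤s (s≤s ())))
small-divisors (inj₂ (inj₂ refl)) _ (suc (suc (suc (suc (suc (suc _)))))) _
  (s≤s (s≤s (s≤s (s≤s (s≤s ())))))

corollary1 : (t k : ℕ) → 1 ≤ t → (k ≡ 1 ⊎ k ≡ 2 ⊎ k ≡ 3) →
    (s'≡ k t (t + k * (k ∸ 1)) ⇔ ((d : ℕ) → 1 ≤ d → d ≤ D k → d ∣ t))
corollary1 t k 1≤t k∈ = mk⇔ (λ s'≡ → small-divisors k∈ (proj₁ (proj₂ s'≡))) (sufficient k∈)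
  where
  sufficient : ∀ {k} → k ≡ 1 ⊎ k ≡ 2 ⊎ k ≡ 3 → (∀ d → 1 ≤ d → d ≤ D k → d ∣ t) →
               s'≡ k t (t + k * (k ∸ 1))
  sufficient (inj₁ refl) ds =
    s'-of-multiple (≤ᵇ⇒≤ 1 3 _) balancedPart-I₁ minimal₂ 1≤t (ds 2 (≤ᵇ⇒≤ 1 2 _) ≤-refl)
  sufficient (inj₂ (inj₁ refl)) ds =
    s'-of-multiple (≤ᵇ⇒≤ 2 3 _) balancedPart-I₂ (minimal₆ ≤-refl) 1≤t
      (lcm-least (ds 2 (≤ᵇ⇒≤ 1 2 _) (≤ᵇ⇒≤ 2 3 _)) (ds 3 (≤ᵇ⇒≤ 1 3 _) ≤-refl))
  sufficient (inj₂ (inj₂ refl)) ds =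
    s'-of-multiple ≤-refl balancedPart-I₃ (minimal₆₀ ≤-refl) 1≤t
      (lcm-least (lcm-least (ds 4 (≤ᵇ⇒≤ 1 4 _) (≤ᵇ⇒≤ 4 5 _)) (ds 3 (≤ᵇ⇒≤ 1 3 _) (≤ᵇ⇒≤ 3 5 _)))
                 (ds 5 (≤ᵇ⇒≤ 1 5 _) ≤-refl))
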